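{- Let $G$ be an undirected graph with marked edges $e_1=\{s_1,t_1\},\dots,e_k=\{s_k,t_k\}$, $k\ge 2$, with self-loops added at every vertex other than the $s_i,t_i$. For $b \in \{0,1\}^{k-1}$ let $P_b$ consist of $(s_1,t_1)$ and, for $2\le i\le k$, of $(s_i,t_i)$ if $b_{i-1}=0$ and $(t_i,s_i)$ otherwise. For $c \in \{0,1\}^{k-2}$ let $Q_c$ consist of $(s_1,s_2)$, $(t_1,t_2)$ and, for $3 \le i \le k$, of $(s_i,t_i)$ if $c_{i-2}=0$ and $(t_i,s_i)$ otherwise. Let $\mathcal{C}_Q$ be the disjoint union over all $c$ of the sets of cycle covers of $G_{Q_c}$, and let $\mathcal{C}_P$ be the disjoint union over all $b$ of the sets of cycle covers of $G_{P_b}$ in which $e_1$ and $e_2$ lie in the same cycle (cycle covers counted with repetition across different patterns). Then there is a bijection between $\mathcal{C}_P$ and $\mathcal{C}_Q$.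
   Context: For a pattern $P$ (a set of ordered pairs of vertices), the pattern graph $G_P$ is the directed graph obtained from $G$ by replacing each undirected edge $\{u,v\}$ (including self-loops) by directed edges $(u,v),(v,u)$ and then, for each $(u,v)\in P$, deleting all outgoing edges of $u$ other than $(u,v)$. A cycle cover of a directed graph is a set of directed edges forming vertex-disjoint simple directed cycles (self-loops allowed) covering every vertex. -}

module Defs where

open import Data.Nat using (ℕ; zero; suc)
open import Data.Fin using (Fin; zero; suc)
open import Data.Bool using (Bool; true; false)
open import Data.Vec using (Vec; lookup; tabulate; toList)
open import Data.List using (List; _∷_)
open import Data.List.Membership.Propositional using (_∈_)
open import Data.Product using (_×_; _,_; Σ; ∃)
open import Data.Refinement using (Refinement-syntax)
open import Relation.Binary.PropositionalEquality using (_≡_)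
open import Function using (_∘_)

Digraph : ℕ → Set₁
Digraph n = Fin n → Fin n → Set

Pattern : ℕ → Set
Pattern n = List (Fin n × Fin n)

-- The symmetric orientation has arcs (u,w) and (w,u)
-- for each edge {u,w}; so its arcs are exactly the pairs with E u w.  For every
-- (u,v) ∈ P all outgoing arcs of u other than (u,v) are deleted: an arc (u,w)
-- survives iff w ≡ v for every (u,v) ∈ P.
PatternGraph : ∀ {n} → Digraph n → Pattern n → Digraph n
PatternGraph E P u w = E u w × (∀ {v} → (u , v) ∈ P → w ≡ v)

-- A set of arcs forming vertex-disjoint simple directed cycles covering all
-- vertices is the same as a set S of arcs in which every vertex has exactly one
-- outgoing and exactly one incoming arc.  We represent S by its successor map
-- σ (S = {(v , σ v)}), stored as a vector so that equality of cycle covers is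
-- plain equality; σ has exactly one incoming arc at each vertex iff it is
-- injective (equivalently bijective, Fin n being finite).
record IsCycleCover {n} (D : Digraph n) (σ : Vec (Fin n) n) : Set where
  field
    arcs      : ∀ v → D v (lookup σ v)
    injective : ∀ u v → lookup σ u ≡ lookup σ v → u ≡ v

-- The set of cycle covers of D (proofs are irrelevant, so a cycle cover is
-- determined by its set of arcs).
CycleCover : ∀ {n} → Digraph n → Set
CycleCover {n} D = [ σ ∈ Vec (Fin n) n ∣ IsCycleCover D σ ]

iter : ∀ {n} → Vec (Fin n) n → ℕ → Fin n → Fin n
iter σ zero    v = v
iter σ (suc m) v = lookup σ (iter σ m v)

SameCycle : ∀ {n} → Vec (Fin n) n → Fin n → Fin n → Set
SameCycle σ u v = ∃ λ m → iter σ m u ≡ v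

orient : ∀ {n} → Bool → Fin n → Fin n → Fin n × Fin n
orient false x y = x , y
orient true  x y = y , x

-- Marked edges e_1 … e_k with k = m + 2 are indexed by Fin (suc (suc m)):
-- index 0 is e_1, index 1 is e_2, index (suc (suc j)) is e_{j+3}.

patP : ∀ {n m} (s t : Fin (suc (suc m)) → Fin n) → Vec Bool (suc m) → Pattern n
patP s t b = (s zero , t zero)
  ∷ toList (tabulate (λ j → orient (lookup b j) (s (suc j)) (t (suc j))))

patQ : ∀ {n m} (s t : Fin (suc (suc m)) → Fin n) → Vec Bool m → Pattern n
patQ s t c = (s zero , s (suc zero)) ∷ (t zero , t (suc zero))
  ∷ toList (tabulate (λ j → orient (lookup c j) (s (suc (suc j))) (t (suc (suc j)))))

-- 𝒞_P: disjoint union over b of the cycle covers of G_{P_b} in which e_1 and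
-- e_2 lie in the same cycle (e_1, e_2 are arcs of every such cover, starting at
-- s_1 resp. at s_2 or t_2, so this says s_2 lies on the cycle through s_1).
CP : ∀ {n m} → Digraph n → (s t : Fin (suc (suc m)) → Fin n) → Set
CP {n} {m} E s t =
  Σ (Vec Bool (suc m)) λ b →
    [ C ∈ CycleCover (PatternGraph E (patP s t b)) ∣
      SameCycle (Refinement.value C) (s zero) (s (suc zero)) ]
  where open import Data.Refinement using (Refinement)

CQ : ∀ {n m} → Digraph n → (s t : Fin (suc (suc m)) → Fin n) → Set
CQ {n} {m} E s t = Σ (Vec Bool m) λ c → CycleCover (PatternGraph E (patQ s t c))

{-# OPTIONS --safe #-}
module Submission where

-- A cycle cover is a permutation f of the vertices. Given a cover in 𝒞_P, follow
-- the walk t₁, f t₁, … up to its first visit of the tail of e₂ (it gets there,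
-- as e₁ and e₂ share a cycle) and reverse this path while redirecting s₁ ↦ s₂
-- and t₁ ↦ t₂: the result is a cover of G_{Q_c}, where c records the marked
-- edges whose orientation flipped because they lie on the path. Conversely, in
-- a cover of G_{Q_c} orient e₂ according to whether t₁ lies on the cycle of s₁,
-- and reverse the path from the tail of e₂ to t₁ while redirecting s₁ ↦ t₁.
-- Both maps are the same path reversal, and reversing the reversed path with
-- the old successors restores the permutation, so the maps are inverse.

open import Data.Bool using (Bool; true; false; not; _xor_)
import Data.Bool as Bool
open import Data.Bool.Properties using (xor-assoc; xor-same; xor-identityʳ)
open import Data.Empty using (⊥-elim)
open import Data.Fin using (Fin; zero; suc; toℕ) renaming (_≟_ to _≟ᶠ_)
open import Data.Fin.Properties using (pigeonhole; toℕ<n)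
open import Data.Irrelevant using ([_])
open import Data.List using (_∷_)
open import Data.List.Membership.Propositional using (_∈_)
open import Data.List.Relation.Unary.Any using (here; there)
open import Data.Nat using (ℕ; zero; suc; pred; _+_; _*_; _∸_; _≤_; _<_; z≤n; s≤s; s≤s⁻¹)
open import Data.Nat.DivMod using (_%_; _/_; m≡m%n+[m/n]*n; m%n<n)
open import Data.Nat.GeneralisedArithmetic using (fold; fold-+)
open import Data.Nat.Properties
open import Data.Product using (_×_; _,_; ∃; proj₁; proj₂)
open import Data.Refinement using (_,_)
open import Data.Sum using (_⊎_; inj₁; inj₂)
open import Data.Vec using (Vec; _∷_; lookup; tabulate; toList)
open import Data.Vec.Membership.Propositional.Properties using (∈-tabulate⁺; ∈-toList⁺; ∈-toList⁻)
open import Data.Vec.Properties using (lookup∘tabulate; tabulate∘lookup; tabulate-cong; ≡-dec)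
import Data.Vec.Relation.Unary.Any.Properties as AnyV
open import Function using (_∘_; Injective)
open import Function.Bundles using (mk⇔; _⤖_; mk↔ₛ′)
open import Function.Properties.Inverse using (↔⇒⤖)
open import Relation.Binary.Definitions using (tri<; tri≈; tri>)
open import Relation.Binary.PropositionalEquality
open import Relation.Nullary using (¬_; Dec; yes; no; does; contradiction)
open import Relation.Nullary.Decidable using (does-⇔; dec-true; dec-false; recompute)
open import Relation.Unary using (Decidable)

open import Defs

private
  variable
    n : ℕ

Least : (ℕ → Set) → ℕ → Set
Least P k = P k × (∀ {j} → j < k → ¬ P j)

Least-unique : ∀ {P i j} → Least P i → Least P j → i ≡ j
Least-unique {i = i} {j} (Pi , i-least) (Pj , j-least) with <-cmp i j
... | tri< i<j _ _ = contradiction Pi (j-least i<j)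
... | tri≈ _ i≡j _ = i≡j
... | tri> _ _ j<i = contradiction Pj (i-least j<i)

-- The least k < B with P k, and B if there is none.
leastBelow : ∀ {P : ℕ → Set} → Decidable P → ℕ → ℕ
leastBelow P? zero = zero
leastBelow P? (suc B) with P? zero
... | yes _ = zero
... | no _  = suc (leastBelow (P? ∘ suc) B)

leastBelow-least : ∀ {P : ℕ → Set} (P? : Decidable P) {k B} → P k → k ≤ B
  → Least P (leastBelow P? B)
leastBelow-least P? {B = zero} Pk z≤n = Pk , λ ()
leastBelow-least P? {B = suc B} Pk k≤B with P? zero
... | yes P0 = P0 , λ ()
leastBelow-least P? {zero} Pk _ | no ¬P0 = contradiction Pk ¬P0
leastBelow-least P? {suc k} Pk (s≤s k≤B) | no ¬P0 with leastBelow-least (P? ∘ suc) Pk k≤B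
... | Pj , j-least = Pj , λ { {zero} _ → ¬P0 ; {suc i} i<j → j-least (s≤s⁻¹ i<j) }

-- Orbits; fold x f k is the iterate f^k x

Reach : (Fin n → Fin n) → Fin n → Fin n → Set
Reach f x y = ∃ λ k → fold x f k ≡ y

ReachBefore : ℕ → (Fin n → Fin n) → Fin n → Fin n → Set
ReachBefore N f x y = ∃ λ k → k < N × fold x f k ≡ y

reachBefore? : ∀ N (f : Fin n → Fin n) x y → Dec (ReachBefore N f x y)
reachBefore? N f x y = anyUpTo? (λ k → fold x f k ≟ᶠ y) N

hittingTime : (Fin n → Fin n) → Fin n → Fin n → ℕ
hittingTime {n} f x y = leastBelow (λ k → fold x f k ≟ᶠ y) n

IsPath : (Fin n → Fin n) → Fin n → ℕ → Set
IsPath f x L = ∀ {i j} → i ≤ L → j ≤ L → fold x f i ≡ fold x f j → i ≡ j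

module _ {n} {f : Fin n → Fin n} where

  fold-suc : ∀ x k → fold x f (suc k) ≡ fold (f x) f k
  fold-suc x zero    = refl
  fold-suc x (suc k) = cong f (fold-suc x k)

  fold-injective : Injective _≡_ _≡_ f → ∀ {x y} k → fold x f k ≡ fold y f k → x ≡ y
  fold-injective f-inj zero    eq = eq
  fold-injective f-inj (suc k) eq = fold-injective f-inj k (f-inj eq)

  module _ {x : Fin n} {p : ℕ} (period : fold x f (suc p) ≡ x) where

    fold-+period : ∀ k → fold x f (k + suc p) ≡ fold x f k
    fold-+period k = trans (fold-+ x f k) (cong (λ z → fold z f k) period)

    fold-*period : ∀ q → fold x f (q * suc p) ≡ x
    fold-*period zero    = refl
    fold-*period (suc q) = begin
      fold x f (suc p + q * suc p)          ≡⟨ fold-+ x f (suc p) ⟩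
      fold (fold x f (q * suc p)) f (suc p) ≡⟨ cong (λ z → fold z f (suc p)) (fold-*period q) ⟩
      fold x f (suc p)                      ≡⟨ period ⟩
      x                                     ∎
      where open ≡-Reasoning

    fold-%period : ∀ k → fold x f k ≡ fold x f (k % suc p)
    fold-%period k = begin
      fold x f k                             ≡⟨ cong (fold x f) (m≡m%n+[m/n]*n k (suc p)) ⟩
      fold x f (r + (k / suc p) * suc p)     ≡⟨ fold-+ x f r ⟩
      fold (fold x f ((k / suc p) * suc p)) f r ≡⟨ cong (λ z → fold z f r) (fold-*period (k / suc p)) ⟩
      fold x f r                             ∎
      where
      open ≡-Reasoning
      r : ℕ
      r = k % suc p

  reach-trans : ∀ {x y z} → Reach f x y → Reach f y z → Reach f x z
  reach-trans {x} (k , refl) (j , refl) = j + k , fold-+ x f j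

  reach-succ : ∀ {x y} → Reach f x y → x ≢ y → Reach f (f x) y
  reach-succ (zero  , eq) x≢y = contradiction eq x≢y
  reach-succ {x} (suc k , eq) _ = k , trans (sym (fold-suc x k)) eq

  reach-within-period : ∀ {x y p} → fold x f (suc p) ≡ x → Reach f x y → ReachBefore (suc p) f x y
  reach-within-period {p = p} period (k , refl) =
    k % suc p , m%n<n k (suc p) , sym (fold-%period period k)

  module _ (f-inj : Injective _≡_ _≡_ f) where

    orbit-returns : ∀ {x i j} → i < j → fold x f i ≡ fold x f j
      → ∃ λ p → p < j × fold x f (suc p) ≡ x
    orbit-returns {x} {i} i<j eq with m≤n⇒∃[o]m+o≡n i<j
    ... | p , refl = p , s≤s (m≤n+m p i) , sym (fold-injective f-inj i (begin
      fold x f i                  ≡⟨ eq ⟩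
      fold x f (suc (i + p))      ≡⟨ cong (fold x f) (sym (+-suc i p)) ⟩
      fold x f (i + suc p)        ≡⟨ fold-+ x f i ⟩
      fold (fold x f (suc p)) f i ∎))
      where open ≡-Reasoning

    periodic : ∀ x → ∃ λ p → p < n × fold x f (suc p) ≡ x
    periodic x with pigeonhole (n<1+n n) (λ i → fold x f (toℕ i))
    ... | i , j , i<j , eq with orbit-returns i<j eq
    ... | p , p<j , period = p , <-≤-trans p<j (s≤s⁻¹ (toℕ<n j)) , period

    reach⇒reachBefore : ∀ {x y} → Reach f x y → ReachBefore n f x y
    reach⇒reachBefore {x} r with periodic x
    ... | p , p<n , period with reach-within-period period r
    ... | k , k<1+p , eq = k , <-≤-trans k<1+p p<n , eq

    reach-sym : ∀ {x y} → Reach f x y → Reach f y x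
    reach-sym {x} r with periodic x
    ... | p , _ , period with reach-within-period period r
    ... | k , k<1+p , refl = suc p ∸ k , (begin
      fold (fold x f k) f (suc p ∸ k) ≡⟨ fold-+ x f (suc p ∸ k) ⟨
      fold x f (suc p ∸ k + k)        ≡⟨ cong (fold x f) (m∸n+n≡m (<⇒≤ k<1+p)) ⟩
      fold x f (suc p)                ≡⟨ period ⟩
      x                               ∎)
      where open ≡-Reasoning

    reach-pred : ∀ {x y} → Reach f x (f y) → Reach f x y
    reach-pred r = reach-trans r (reach-sym (1 , refl))

    hittingTime-least : ∀ {x y} → Reach f x y
      → Least (λ k → fold x f k ≡ y) (hittingTime f x y)
    hittingTime-least r with reach⇒reachBefore r
    ... | k , k<n , eq = leastBelow-least _ eq (<⇒≤ k<n)

    least-no-repeat : ∀ {x y L} → Least (λ k → fold x f k ≡ y) L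
      → ∀ {i j} → i < j → j ≤ L → fold x f i ≢ fold x f j
    least-no-repeat {x} {y} {L} (hit , before) i<j j≤L eq with orbit-returns i<j eq
    ... | p , p<j , period = before (∸-monoʳ-< (s≤s z≤n) p<L) (begin
      fold x f (L ∸ suc p)          ≡⟨ fold-+period period (L ∸ suc p) ⟨
      fold x f (L ∸ suc p + suc p)  ≡⟨ cong (fold x f) (m∸n+n≡m p<L) ⟩
      fold x f L                    ≡⟨ hit ⟩
      y                             ∎)
      where
      open ≡-Reasoning
      p<L : suc p ≤ L
      p<L = ≤-trans p<j j≤L

    least⇒isPath : ∀ {x y L} → Least (λ k → fold x f k ≡ y) L → IsPath f x L
    least⇒isPath least {i} {j} i≤L j≤L eq with <-cmp i j
    ... | tri< i<j _ _ = contradiction eq (least-no-repeat least i<j j≤L)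
    ... | tri≈ _ i≡j _ = i≡j
    ... | tri> _ _ j<i = contradiction (sym eq) (least-no-repeat least j<i i≤L)

predecessor-off-path : ∀ {n} {f : Fin n → Fin n} {x L a}
  → IsPath f x L → f a ≡ x → a ≢ fold x f L → ¬ ReachBefore (suc L) f x a
predecessor-off-path path fa≡x a≢y (k , k<1+L , refl) with m≤n⇒m<n∨m≡n (s≤s⁻¹ k<1+L)
... | inj₁ k<L  = contradiction (path k<L z≤n fa≡x) λ ()
... | inj₂ refl = a≢y refl

-- Reversing a path

patch-injective : ∀ {A : Set} {f g : A → A} (D : A → Set) → Injective _≡_ _≡_ f
  → (∀ v → D v ⊎ g v ≡ f v)
  → (∀ {u v} → D u → D v → g u ≡ g v → u ≡ v)
  → (∀ {u} → D u → ∃ λ z → D z × f z ≡ g u)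
  → Injective _≡_ _≡_ g
patch-injective D f-inj split D-inj D-image {u} {v} gu≡gv with split u | split v
... | inj₁ Du | inj₁ Dv = D-inj Du Dv gu≡gv
... | inj₁ Du | inj₂ gv≡fv with D-image Du
...   | z , Dz , fz≡gu = D-inj Du (subst D (f-inj (trans fz≡gu (trans gu≡gv gv≡fv))) Dz) gu≡gv
patch-injective D f-inj split D-inj D-image {u} {v} gu≡gv | inj₂ gu≡fu | inj₁ Dv with D-image Dv
...   | z , Dz , fz≡gv = D-inj (subst D (f-inj (trans fz≡gv (trans (sym gu≡gv) gu≡fu))) Dz) Dv gu≡gv
patch-injective D f-inj split D-inj D-image {u} {v} gu≡gv | inj₂ gu≡fu | inj₂ gv≡fv =
  f-inj (trans (sym gu≡fu) (trans gu≡gv gv≡fv))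

Follows : (Fin n → Fin n) → Fin n × Fin n → Set
Follows h e = h (proj₁ e) ≡ proj₂ e

reversal : (Fin n → Fin n) → Fin n → ℕ → (a va vx : Fin n) → Fin n → Fin n
reversal f x L a va vx v with v ≟ᶠ a | v ≟ᶠ x | reachBefore? (suc L) f x v
... | yes _ | _     | _           = va
... | no _  | yes _ | _           = vx
... | no _  | no _  | yes (k , _) = fold x f (pred k)
... | no _  | no _  | no _        = f v

module Reversal {n} {f : Fin n → Fin n} {x : Fin n} {L : ℕ} (path : IsPath f x L)
                {a : Fin n} (a∉path : ¬ ReachBefore (suc L) f x a) (va vx : Fin n) where

  y : Fin n
  y = fold x f L

  g : Fin n → Fin n
  g = reversal f x L a va vx

  OnPath : Fin n → Set
  OnPath = ReachBefore (suc L) f x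

  x≢a : x ≢ a
  x≢a x≡a = a∉path (0 , s≤s z≤n , x≡a)

  reversal-a : g a ≡ va
  reversal-a with a ≟ᶠ a
  ... | yes _   = refl
  ... | no a≢a = contradiction refl a≢a

  reversal-x : g x ≡ vx
  reversal-x with x ≟ᶠ a | x ≟ᶠ x
  ... | yes x≡a | _     = contradiction x≡a x≢a
  ... | no _    | yes _ = refl
  ... | no _    | no x≢x = contradiction refl x≢x

  reversal-pred : ∀ {k} → k < L → g (fold x f (suc k)) ≡ fold x f k
  reversal-pred {k} k<L
    with fold x f (suc k) ≟ᶠ a | fold x f (suc k) ≟ᶠ x | reachBefore? (suc L) f x (fold x f (suc k))
  ... | yes on≡a | _ | _ = contradiction (suc k , s≤s k<L , on≡a) a∉path
  ... | no _ | yes on≡x | _ = contradiction (path k<L z≤n on≡x) λ ()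
  ... | no _ | no _ | yes (j , j<1+L , eq) = cong (fold x f ∘ pred) (path (s≤s⁻¹ j<1+L) k<L eq)
  ... | no _ | no _ | no ∉ = contradiction (suc k , s≤s k<L , refl) ∉

  reversal-outside : ∀ {v} → v ≢ a → ¬ OnPath v → g v ≡ f v
  reversal-outside {v} v≢a v∉ with v ≟ᶠ a | v ≟ᶠ x | reachBefore? (suc L) f x v
  ... | yes v≡a | _ | _ = contradiction v≡a v≢a
  ... | no _ | yes v≡x | _ = contradiction (0 , s≤s z≤n , sym v≡x) v∉
  ... | no _ | no _ | yes on = contradiction on v∉
  ... | no _ | no _ | no _ = refl

  data Rerouted : Fin n → Set where
    source   : Rerouted a
    start    : Rerouted x
    interior : ∀ {k} → k < L → Rerouted (fold x f (suc k))

  classify : ∀ v → Rerouted v ⊎ (v ≢ a × ¬ OnPath v)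
  classify v with v ≟ᶠ a | v ≟ᶠ x | reachBefore? (suc L) f x v
  ... | yes refl | _ | _ = inj₁ source
  ... | no _ | yes refl | _ = inj₁ start
  ... | no _ | no v≢x | yes (zero , _ , x≡v) = contradiction (sym x≡v) v≢x
  ... | no _ | no _ | yes (suc k , s≤s k<L , refl) = inj₁ (interior k<L)
  ... | no v≢a | no _ | no v∉ = inj₂ (v≢a , v∉)

  onPath-rerouted : ∀ {k} → k ≤ L → Rerouted (fold x f k)
  onPath-rerouted {zero}  _   = start
  onPath-rerouted {suc k} k<L = interior k<L

  -- The reversal redefines the successors of the Rerouted vertices D; it maps D
  -- onto f D, and is then injective, when {va , vx , x} = {f a , y , f y}.
  Boundary : Fin n → Set
  Boundary v = v ≡ f a ⊎ v ≡ y ⊎ v ≡ f y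

  Image : Fin n → Set
  Image v = ∃ λ u → Rerouted u × f u ≡ v

  boundary-image : ∀ {v} → Boundary v → (v ≡ y → 0 < L) → Image v
  boundary-image (inj₁ refl)        _   = a , source , refl
  boundary-image (inj₂ (inj₂ refl)) _   = y , onPath-rerouted ≤-refl , refl
  boundary-image (inj₂ (inj₁ refl)) 0<L with m≤n⇒∃[o]m+o≡n (0<L refl)
  ... | l , 1+l≡L =
    fold x f l , onPath-rerouted (≤-trans (n≤1+n l) (≤-reflexive 1+l≡L)) , cong (fold x f) 1+l≡L

  ≡y⇒0<L : ∀ {v} → v ≢ x → v ≡ y → 0 < L
  ≡y⇒0<L v≢x v≡y = n≢0⇒n>0 λ L≡0 → v≢x (trans v≡y (cong (fold x f) L≡0))

  module _ (f-inj : Injective _≡_ _≡_ f) where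

    boundary-off-path : ∀ {v} → Boundary v → v ≢ x → ∀ {k} → k < L → fold x f k ≢ v
    boundary-off-path (inj₁ refl) v≢x {zero} _ = v≢x ∘ sym
    boundary-off-path (inj₁ refl) _ {suc k} k<L eq =
      a∉path (k , <-trans (n<1+n k) (s≤s (<⇒≤ k<L)) , f-inj eq)
    boundary-off-path (inj₂ (inj₁ refl)) _ k<L eq = <-irrefl (path (<⇒≤ k<L) ≤-refl eq) k<L
    boundary-off-path (inj₂ (inj₂ refl)) v≢x {zero} _ = v≢x ∘ sym
    boundary-off-path (inj₂ (inj₂ refl)) _ {suc k} k<L eq =
      <-irrefl (path (<⇒≤ (<-trans (n<1+n k) k<L)) ≤-refl (f-inj eq)) (<-trans (n<1+n k) k<L)

    module _ (va≢vx : va ≢ vx) (va≢x : va ≢ x) (vx≢x : vx ≢ x)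
             (va-bd : Boundary va) (vx-bd : Boundary vx) (x-bd : Boundary x) where

      va≢interior : ∀ {k} → k < L → va ≢ g (fold x f (suc k))
      va≢interior k<L va≡ = boundary-off-path va-bd va≢x k<L (sym (trans va≡ (reversal-pred k<L)))

      vx≢interior : ∀ {k} → k < L → vx ≢ g (fold x f (suc k))
      vx≢interior k<L vx≡ = boundary-off-path vx-bd vx≢x k<L (sym (trans vx≡ (reversal-pred k<L)))

      rerouted-injective : ∀ {u v} → Rerouted u → Rerouted v → g u ≡ g v → u ≡ v
      rerouted-injective source source _ = refl
      rerouted-injective start  start  _ = refl
      rerouted-injective (interior k<L) (interior j<L) eq =
        cong f (trans (sym (reversal-pred k<L)) (trans eq (reversal-pred j<L)))
      rerouted-injective source start eq = ⊥-elim (va≢vx (trans (sym reversal-a) (trans eq reversal-x)))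
      rerouted-injective start source eq = ⊥-elim (va≢vx (trans (sym reversal-a) (trans (sym eq) reversal-x)))
      rerouted-injective source (interior k<L) eq = ⊥-elim (va≢interior k<L (trans (sym reversal-a) eq))
      rerouted-injective (interior k<L) source eq = ⊥-elim (va≢interior k<L (trans (sym reversal-a) (sym eq)))
      rerouted-injective start (interior k<L) eq  = ⊥-elim (vx≢interior k<L (trans (sym reversal-x) eq))
      rerouted-injective (interior k<L) start eq  = ⊥-elim (vx≢interior k<L (trans (sym reversal-x) (sym eq)))

      rerouted-image : ∀ {u} → Rerouted u → ∃ λ z → Rerouted z × f z ≡ g u
      rerouted-image source = subst Image (sym reversal-a) (boundary-image va-bd (≡y⇒0<L va≢x))
      rerouted-image start  = subst Image (sym reversal-x) (boundary-image vx-bd (≡y⇒0<L vx≢x))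
      rerouted-image (interior {zero} 0<L) =
        subst Image (sym (reversal-pred 0<L)) (boundary-image x-bd λ _ → 0<L)
      rerouted-image (interior {suc k} k<L) =
        fold x f k , onPath-rerouted (<⇒≤ (<-trans (n<1+n k) k<L)) , sym (reversal-pred k<L)

      reversal-injective : Injective _≡_ _≡_ g
      reversal-injective = patch-injective Rerouted f-inj split rerouted-injective rerouted-image
        where
        split : ∀ v → Rerouted v ⊎ g v ≡ f v
        split v with classify v
        ... | inj₁ r = inj₁ r
        ... | inj₂ (v≢a , v∉) = inj₂ (reversal-outside v≢a v∉)

  reversal-arcs : (E : Fin n → Fin n → Set) → (∀ u v → E u v → E v u)
    → E a va → E x vx → (∀ v → E v (f v)) → ∀ v → E v (g v)
  reversal-arcs E E-sym Eava Exvx E-f v with classify v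
  ... | inj₁ source = subst (E a) (sym reversal-a) Eava
  ... | inj₁ start  = subst (E x) (sym reversal-x) Exvx
  ... | inj₁ (interior {k} k<L) = subst (E v) (sym (reversal-pred k<L)) (E-sym _ _ (E-f (fold x f k)))
  ... | inj₂ (v≢a , v∉) = subst (E v) (sym (reversal-outside v≢a v∉)) (E-f v)

  reversal-follows : Injective _≡_ _≡_ f → ∀ {S T} → S ≢ a → T ≢ a → S ≢ x → S ≢ y → T ≢ y
    → ∀ β → Follows f (orient β S T)
    → Follows g (orient (β xor does (reachBefore? (suc L) f x S)) S T)
  reversal-follows f-inj {S} {T} S≢a T≢a S≢x S≢y T≢y β f-follows with reachBefore? (suc L) f x S | β
  ... | no S∉ | false = trans (reversal-outside S≢a S∉) f-follows
  ... | no S∉ | true  = trans (reversal-outside T≢a T∉) f-follows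
    where
    T∉ : ¬ OnPath T
    T∉ (k , k<1+L , refl) with m≤n⇒m<n∨m≡n (s≤s⁻¹ k<1+L)
    ... | inj₁ k<L  = S∉ (suc k , s≤s k<L , f-follows)
    ... | inj₂ refl = T≢y refl
  ... | yes (k , k<1+L , refl) | false with m≤n⇒m<n∨m≡n (s≤s⁻¹ k<1+L)
  ...   | inj₁ k<L  = trans (cong g (sym f-follows)) (reversal-pred k<L)
  ...   | inj₂ refl = contradiction refl S≢y
  reversal-follows f-inj S≢a T≢a S≢x S≢y T≢y β f-follows | yes (zero , _ , refl) | true =
    contradiction refl S≢x
  reversal-follows f-inj S≢a T≢a S≢x S≢y T≢y β f-follows | yes (suc k , s≤s k<L , refl) | true =
    trans (reversal-pred k<L) (f-inj (sym f-follows))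

module Reversed {n} {f : Fin n → Fin n} {x : Fin n} {L : ℕ} (path : IsPath f x L)
                {a : Fin n} (a∉path : ¬ ReachBefore (suc L) f x a) {va vx : Fin n}
                {h : Fin n → Fin n} (h≗g : ∀ v → h v ≡ reversal f x L a va vx v) where

  open Reversal path a∉path va vx

  walk : ∀ {k} → k ≤ L → fold y h k ≡ fold x f (L ∸ k)
  walk {zero}  _   = refl
  walk {suc k} k<L = begin
    h (fold y h k)                 ≡⟨ cong h (walk (<⇒≤ k<L)) ⟩
    h (fold x f (L ∸ k))           ≡⟨ cong (h ∘ fold x f) (+-∸-assoc 1 k<L) ⟩
    h (fold x f (suc (L ∸ suc k))) ≡⟨ h≗g _ ⟩
    g (fold x f (suc (L ∸ suc k))) ≡⟨ reversal-pred (∸-monoʳ-< (s≤s z≤n) k<L) ⟩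
    fold x f (L ∸ suc k)           ∎
    where open ≡-Reasoning

  isPath : IsPath h y L
  isPath {i} {j} i≤L j≤L eq = ∸-cancelˡ-≡ i≤L j≤L
    (path (m∸n≤m L i) (m∸n≤m L j) (trans (sym (walk i≤L)) (trans eq (walk j≤L))))

  hits : Least (λ k → fold y h k ≡ x) L
  hits = trans (walk ≤-refl) (cong (fold x f) (n∸n≡0 L)) , λ {j} j<L eq →
    <⇒≢ (m<n⇒0<n∸m j<L) (sym (path (m∸n≤m L j) z≤n (trans (sym (walk (<⇒≤ j<L))) eq)))

  onPath⁻ : ∀ {v} → ReachBefore (suc L) h y v → OnPath v
  onPath⁻ (k , k<1+L , refl) = L ∸ k , s≤s (m∸n≤m L k) , sym (walk (s≤s⁻¹ k<1+L))

  onPath⁺ : ∀ {v} → OnPath v → ReachBefore (suc L) h y v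
  onPath⁺ (k , k<1+L , refl) =
    L ∸ k , s≤s (m∸n≤m L k)
          , trans (walk (m∸n≤m L k)) (cong (fold x f) (m∸[m∸n]≡n (s≤s⁻¹ k<1+L)))

  onPath-does : ∀ {x′ L′} → x′ ≡ y → L′ ≡ L
    → ∀ v → does (reachBefore? (suc L′) h x′ v) ≡ does (reachBefore? (suc L) f x v)
  onPath-does refl refl v =
    does-⇔ (mk⇔ onPath⁻ onPath⁺) (reachBefore? (suc L) h y v) (reachBefore? (suc L) f x v)

  module Back = Reversal isPath (a∉path ∘ onPath⁻) (f a) (f y)

  involutive : ∀ {x′ L′ va′ vx′} → x′ ≡ y → L′ ≡ L → va′ ≡ f a → vx′ ≡ f y
    → ∀ v → reversal h x′ L′ a va′ vx′ v ≡ f v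
  involutive refl refl refl refl v with Back.classify v
  ... | inj₁ Back.source = Back.reversal-a
  ... | inj₁ Back.start  = Back.reversal-x
  ... | inj₁ (Back.interior {k} k<L) = begin
    Back.g (fold y h (suc k))       ≡⟨ Back.reversal-pred k<L ⟩
    fold y h k                      ≡⟨ walk (<⇒≤ k<L) ⟩
    fold x f (L ∸ k)                ≡⟨ cong (fold x f) (+-∸-assoc 1 k<L) ⟩
    f (fold x f (L ∸ suc k))        ≡⟨ cong f (walk k<L) ⟨
    f (fold y h (suc k))            ∎
    where open ≡-Reasoning
  ... | inj₂ (v≢a , v∉) = begin
    Back.g v ≡⟨ Back.reversal-outside v≢a v∉ ⟩
    h v      ≡⟨ h≗g v ⟩
    g v      ≡⟨ reversal-outside v≢a (v∉ ∘ onPath⁺) ⟩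
    f v      ∎
    where open ≡-Reasoning

-- Patterns and cycle covers

iter≡fold : ∀ {n} (σ : Vec (Fin n) n) k x → iter σ k x ≡ fold x (lookup σ) k
iter≡fold σ zero    x = refl
iter≡fold σ (suc k) x = cong (lookup σ) (iter≡fold σ k x)

sameCycle⇒reach : ∀ {n} {σ : Vec (Fin n) n} {x y} → SameCycle σ x y → Reach (lookup σ) x y
sameCycle⇒reach {σ = σ} {x} (k , eq) = k , trans (sym (iter≡fold σ k x)) eq

reach⇒sameCycle : ∀ {n} {σ : Vec (Fin n) n} {x y} → Reach (lookup σ) x y → SameCycle σ x y
reach⇒sameCycle {σ = σ} {x} (k , eq) = k , trans (iter≡fold σ k x) eq

Respects : (Fin n → Fin n) → Pattern n → Set
Respects h P = ∀ {u v} → (u , v) ∈ P → h u ≡ v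

module _ {n} {h : Fin n → Fin n} where

  respects-∷ : ∀ {e P} → Follows h e → Respects h P → Respects h (e ∷ P)
  respects-∷ he _  (here refl) = he
  respects-∷ _  hP (there mem) = hP mem

  respects-head : ∀ {e P} → Respects h (e ∷ P) → Follows h e
  respects-head hP = hP (here refl)

  respects-tail : ∀ {e P} → Respects h (e ∷ P) → Respects h P
  respects-tail hP mem = hP (there mem)

  respects-tabulate : ∀ {k} {es : Fin k → Fin n × Fin n}
    → (∀ j → Follows h (es j)) → Respects h (toList (tabulate es))
  respects-tabulate follows mem with AnyV.tabulate⁻ (∈-toList⁻ mem)
  ... | j , refl = follows j

  tabulate-respects : ∀ {k} (es : Fin k → Fin n × Fin n)
    → Respects h (toList (tabulate es)) → ∀ j → Follows h (es j)
  tabulate-respects es hP j = hP (∈-toList⁺ (∈-tabulate⁺ es j))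

module _ {n} {E : Digraph n} {P : Pattern n} where

  module _ {σ : Vec (Fin n) n} (cover : IsCycleCover (PatternGraph E P) σ) where

    cover-injective : Injective _≡_ _≡_ (lookup σ)
    cover-injective = IsCycleCover.injective cover _ _

    cover-arcs : ∀ v → E v (lookup σ v)
    cover-arcs v = proj₁ (IsCycleCover.arcs cover v)

    cover-respects : Respects (lookup σ) P
    cover-respects {u} = proj₂ (IsCycleCover.arcs cover u)

  tabulate-isCycleCover : ∀ {g : Fin n → Fin n} → Injective _≡_ _≡_ g → (∀ v → E v (g v)) → Respects g P
    → IsCycleCover (PatternGraph E P) (tabulate g)
  tabulate-isCycleCover {g} g-inj g-arcs g-respects = record
    { arcs      = λ v → subst (E v) (sym (lookup∘tabulate g v)) (g-arcs v)
                      , λ mem → trans (lookup∘tabulate g v) (g-respects mem)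
    ; injective = λ u v eq → g-inj (trans (sym (lookup∘tabulate g u)) (trans eq (lookup∘tabulate g v)))
    }

toggle : ∀ {k} → Vec Bool k → (Fin k → Bool) → Vec Bool k
toggle c d = tabulate (λ j → lookup c j xor d j)

toggle-involutive : ∀ {k} (c : Vec Bool k) {d d′ : Fin k → Bool}
  → (∀ j → d j ≡ d′ j) → toggle (toggle c d) d′ ≡ c
toggle-involutive c {d} {d′} d≗d′ = trans (tabulate-cong untoggle) (tabulate∘lookup c)
  where
  open ≡-Reasoning
  untoggle : ∀ j → lookup (toggle c d) j xor d′ j ≡ lookup c j
  untoggle j = begin
    lookup (toggle c d) j xor d′ j   ≡⟨ cong₂ _xor_ (lookup∘tabulate _ j) (sym (d≗d′ j)) ⟩
    (lookup c j xor d j) xor d j     ≡⟨ xor-assoc (lookup c j) (d j) (d j) ⟩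
    lookup c j xor (d j xor d j)     ≡⟨ cong (lookup c j xor_) (xor-same (d j)) ⟩
    lookup c j xor false             ≡⟨ xor-identityʳ (lookup c j) ⟩
    lookup c j                       ∎

-- The two maps

module MarkedEdges {n m : ℕ} (E : Digraph n) (s t : Fin (suc (suc m)) → Fin n)
  (E-sym : ∀ u v → E u v → E v u) (E-st : ∀ i → E (s i) (t i))
  (s-inj : ∀ i j → s i ≡ s j → i ≡ j) (t-inj : ∀ i j → t i ≡ t j → i ≡ j)
  (s≢t : ∀ i j → s i ≢ t j)
  (E-s₁s₂ : E (s zero) (s (suc zero))) (E-t₁t₂ : E (t zero) (t (suc zero))) where

  s₁ t₁ s₂ t₂ : Fin n
  s₁ = s zero
  t₁ = t zero
  s₂ = s (suc zero)
  t₂ = t (suc zero)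

  s₃₊ t₃₊ : Fin m → Fin n
  s₃₊ j = s (suc (suc j))
  t₃₊ j = t (suc (suc j))

  tail₂ head₂ : Bool → Fin n
  tail₂ β = proj₁ (orient β s₂ t₂)
  head₂ β = proj₂ (orient β s₂ t₂)

  s-distinct : ∀ {i j} → i ≢ j → s i ≢ s j
  s-distinct i≢j = i≢j ∘ s-inj _ _

  t-distinct : ∀ {i j} → i ≢ j → t i ≢ t j
  t-distinct i≢j = i≢j ∘ t-inj _ _

  t≢s : ∀ i j → t i ≢ s j
  t≢s i j = s≢t j i ∘ sym

  s₁≢s₂ : s₁ ≢ s₂
  s₁≢s₂ = s-distinct λ ()

  avoids-e₂ : ∀ {v} → v ≢ s₂ → v ≢ t₂ → ∀ β → v ≢ tail₂ β × v ≢ head₂ β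
  avoids-e₂ v≢s₂ v≢t₂ false = v≢s₂ , v≢t₂
  avoids-e₂ v≢s₂ v≢t₂ true  = v≢t₂ , v≢s₂

  e₂-ends : ∀ {v} → v ≡ s₂ ⊎ v ≡ t₂ → ∀ β → v ≡ tail₂ β ⊎ v ≡ head₂ β
  e₂-ends (inj₁ v≡s₂) false = inj₁ v≡s₂
  e₂-ends (inj₂ v≡t₂) false = inj₂ v≡t₂
  e₂-ends (inj₁ v≡s₂) true  = inj₂ v≡s₂
  e₂-ends (inj₂ v≡t₂) true  = inj₁ v≡t₂

  tail₂-end : ∀ β → tail₂ β ≡ s₂ ⊎ tail₂ β ≡ t₂
  tail₂-end false = inj₁ refl
  tail₂-end true  = inj₂ refl

  head₂-end : ∀ β → head₂ β ≡ s₂ ⊎ head₂ β ≡ t₂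
  head₂-end false = inj₂ refl
  head₂-end true  = inj₁ refl

  tail₂≢head₂ : ∀ β → tail₂ β ≢ head₂ β
  tail₂≢head₂ false = s≢t _ _
  tail₂≢head₂ true  = t≢s _ _

  E-e₂ : ∀ β → E (tail₂ β) (head₂ β)
  E-e₂ false = E-st (suc zero)
  E-e₂ true  = E-sym _ _ (E-st (suc zero))

  reach-s₂ : ∀ {g : Fin n → Fin n} {u} β → Reach g u (tail₂ β) → g (tail₂ β) ≡ head₂ β → Reach g u s₂
  reach-s₂ false u⇝s₂ _    = u⇝s₂
  reach-s₂ true  u⇝t₂ g-t₂ = reach-trans u⇝t₂ (1 , g-t₂)

  patP-follows : ∀ {h} b → Respects h (patP s t b)
    → ∀ j → Follows h (orient (lookup b j) (s (suc j)) (t (suc j)))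
  patP-follows b = tabulate-respects (λ j → orient (lookup b j) (s (suc j)) (t (suc j))) ∘ respects-tail

  patQ-follows : ∀ {h} c → Respects h (patQ s t c)
    → ∀ j → Follows h (orient (lookup c j) (s₃₊ j) (t₃₊ j))
  patQ-follows c =
    tabulate-respects (λ j → orient (lookup c j) (s₃₊ j) (t₃₊ j)) ∘ respects-tail ∘ respects-tail

  patP-respects : ∀ {h} b → h s₁ ≡ t₁ → (∀ j → Follows h (orient (lookup b j) (s (suc j)) (t (suc j))))
    → Respects h (patP s t b)
  patP-respects {h} b h-s₁ follows = respects-∷ {h = h} h-s₁ (respects-tabulate {h = h} follows)

  patQ-respects : ∀ {h} c → h s₁ ≡ s₂ → h t₁ ≡ t₂
    → (∀ j → Follows h (orient (lookup c j) (s₃₊ j) (t₃₊ j))) → Respects h (patQ s t c)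
  patQ-respects {h} c h-s₁ h-t₁ follows =
    respects-∷ {h = h} h-s₁ (respects-∷ {h = h} h-t₁ (respects-tabulate {h = h} follows))

  onPath-bits : (Fin n → Fin n) → Fin n → ℕ → Fin m → Bool
  onPath-bits f x L j = does (reachBefore? (suc L) f x (s₃₊ j))

  toQ-length : Vec (Fin n) n → Bool → ℕ
  toQ-length σ b₀ = hittingTime (lookup σ) t₁ (tail₂ b₀)

  toQ-succ : Vec (Fin n) n → Bool → Fin n → Fin n
  toQ-succ σ b₀ = reversal (lookup σ) t₁ (toQ-length σ b₀) s₁ s₂ t₂

  toQ-bits : Vec (Fin n) n → Bool → Vec Bool m → Vec Bool m
  toQ-bits σ b₀ bs = toggle bs (onPath-bits (lookup σ) t₁ (toQ-length σ b₀))

  -- e₂ gets reversed exactly when t₁ is not on the cycle of s₁; as orbits have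
  -- at most n points, n steps decide this.
  fromQ-bit : Vec (Fin n) n → Bool
  fromQ-bit τ = not (does (reachBefore? n (lookup τ) s₁ t₁))

  fromQ-length : Vec (Fin n) n → ℕ
  fromQ-length τ = hittingTime (lookup τ) (tail₂ (fromQ-bit τ)) t₁

  fromQ-succ : Vec (Fin n) n → Fin n → Fin n
  fromQ-succ τ =
    reversal (lookup τ) (tail₂ (fromQ-bit τ)) (fromQ-length τ) s₁ t₁ (head₂ (fromQ-bit τ))

  fromQ-bits : Vec (Fin n) n → Vec Bool m → Vec Bool (suc m)
  fromQ-bits τ c =
    fromQ-bit τ ∷ toggle c (onPath-bits (lookup τ) (tail₂ (fromQ-bit τ)) (fromQ-length τ))

  module ToQ (σ : Vec (Fin n) n) (b₀ : Bool) (bs : Vec Bool m)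
             (cover : IsCycleCover (PatternGraph E (patP s t (b₀ ∷ bs))) σ)
             (same : Reach (lookup σ) s₁ s₂) where

    f : Fin n → Fin n
    f = lookup σ

    f-inj : Injective _≡_ _≡_ f
    f-inj = cover-injective cover

    f-s₁ : f s₁ ≡ t₁
    f-s₁ = respects-head (cover-respects cover)

    f-e₂ : f (tail₂ b₀) ≡ head₂ b₀
    f-e₂ = patP-follows (b₀ ∷ bs) (cover-respects cover) zero

    f-marked : ∀ j → Follows f (orient (lookup bs j) (s₃₊ j) (t₃₊ j))
    f-marked j = patP-follows (b₀ ∷ bs) (cover-respects cover) (suc j)

    reach-tail₂ : Reach f t₁ (tail₂ b₀)
    reach-tail₂ = from-t₁ b₀ f-e₂
      where
      t₁⇝s₂ : Reach f t₁ s₂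
      t₁⇝s₂ = subst (λ z → Reach f z s₂) f-s₁ (reach-succ same s₁≢s₂)
      from-t₁ : ∀ β → f (tail₂ β) ≡ head₂ β → Reach f t₁ (tail₂ β)
      from-t₁ false _    = t₁⇝s₂
      from-t₁ true  f-t₂ = reach-pred f-inj (subst (Reach f t₁) (sym f-t₂) t₁⇝s₂)

    L : ℕ
    L = toQ-length σ b₀

    least : Least (λ k → fold t₁ f k ≡ tail₂ b₀) L
    least = hittingTime-least f-inj reach-tail₂

    path : IsPath f t₁ L
    path = least⇒isPath f-inj least

    s₁∉path : ¬ ReachBefore (suc L) f t₁ s₁
    s₁∉path = predecessor-off-path path f-s₁ λ s₁≡y →
      proj₁ (avoids-e₂ s₁≢s₂ (s≢t _ _) b₀) (trans s₁≡y (proj₁ least))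

    open Reversal path s₁∉path s₂ t₂

    y≡tail₂ : y ≡ tail₂ b₀
    y≡tail₂ = proj₁ least

    e₂-boundary : ∀ {v} → v ≡ s₂ ⊎ v ≡ t₂ → Boundary v
    e₂-boundary v∈e₂ with e₂-ends v∈e₂ b₀
    ... | inj₁ v≡tail = inj₂ (inj₁ (trans v≡tail (sym y≡tail₂)))
    ... | inj₂ v≡head = inj₂ (inj₂ (trans v≡head (trans (sym f-e₂) (cong f (sym y≡tail₂)))))

    g-injective : Injective _≡_ _≡_ g
    g-injective = reversal-injective f-inj (s≢t _ _) (s≢t _ _) (t-distinct λ ())
      (e₂-boundary (inj₁ refl)) (e₂-boundary (inj₂ refl)) (inj₁ (sym f-s₁))

    g-follows : ∀ j → Follows g (orient (lookup (toQ-bits σ b₀ bs) j) (s₃₊ j) (t₃₊ j))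
    g-follows j = subst (λ β → Follows g (orient β (s₃₊ j) (t₃₊ j))) (sym (lookup∘tabulate _ j))
      (reversal-follows f-inj (s-distinct λ ()) (t≢s _ _) (s≢t _ _)
        (≢y (s-distinct λ ()) (s≢t _ _)) (≢y (t≢s _ _) (t-distinct λ ())) (lookup bs j) (f-marked j))
      where
      ≢y : ∀ {v} → v ≢ s₂ → v ≢ t₂ → v ≢ y
      ≢y v≢s₂ v≢t₂ v≡y = proj₁ (avoids-e₂ v≢s₂ v≢t₂ b₀) (trans v≡y y≡tail₂)

    isCover : IsCycleCover (PatternGraph E (patQ s t (toQ-bits σ b₀ bs))) (tabulate g)
    isCover = tabulate-isCycleCover g-injective
      (reversal-arcs E E-sym E-s₁s₂ E-t₁t₂ (cover-arcs cover))
      (patQ-respects {g} (toQ-bits σ b₀ bs) reversal-a reversal-x g-follows)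

    τ : Vec (Fin n) n
    τ = tabulate g

    h : Fin n → Fin n
    h = lookup τ

    h-inj : Injective _≡_ _≡_ h
    h-inj = cover-injective isCover

    module Back = Reversed path s₁∉path (lookup∘tabulate g)

    h-t₁ : b₀ ≡ true → h t₁ ≡ y
    h-t₁ refl = trans (lookup∘tabulate g t₁) (trans reversal-x (sym y≡tail₂))

    t₁-period : b₀ ≡ true → fold t₁ h (suc L) ≡ t₁
    t₁-period b₀≡true =
      trans (fold-suc t₁ L) (trans (cong (λ z → fold z h L) (h-t₁ b₀≡true)) (proj₁ Back.hits))

    t₁-cycle-avoids-s₁ : b₀ ≡ true → ¬ Reach h s₁ t₁
    t₁-cycle-avoids-s₁ b₀≡true s₁⇝t₁ =
      avoid (reach-within-period (t₁-period b₀≡true) (reach-sym h-inj s₁⇝t₁))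
      where
      open ≡-Reasoning
      avoid : ¬ ReachBefore (suc L) h t₁ s₁
      avoid (zero  , _ , t₁≡s₁) = t≢s _ _ t₁≡s₁
      avoid (suc k , k<1+L , eq) = s₁∉path (L ∸ k , s≤s (m∸n≤m L k) , (begin
        fold t₁ f (L ∸ k)   ≡⟨ Back.walk (<⇒≤ (s≤s⁻¹ k<1+L)) ⟨
        fold y h k          ≡⟨ cong (λ z → fold z h k) (h-t₁ b₀≡true) ⟨
        fold (h t₁) h k     ≡⟨ fold-suc t₁ k ⟨
        fold t₁ h (suc k)   ≡⟨ eq ⟩
        s₁                  ∎))

    bit-back : fromQ-bit τ ≡ b₀
    bit-back = decide b₀ refl
      where
      decide : ∀ β → b₀ ≡ β → fromQ-bit τ ≡ β
      decide false refl =
        cong not (dec-true (reachBefore? n h s₁ t₁) (reach⇒reachBefore h-inj s₁⇝t₁))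
        where
        s₁⇝t₁ : Reach h s₁ t₁
        s₁⇝t₁ = reach-trans (1 , trans (lookup∘tabulate g s₁) reversal-a)
                  (subst (λ z → Reach h z t₁) y≡tail₂ (L , proj₁ Back.hits))
      decide true b₀≡true = cong not (dec-false (reachBefore? n h s₁ t₁)
        (t₁-cycle-avoids-s₁ b₀≡true ∘ λ (k , _ , eq) → k , eq))

    length-back : fromQ-length τ ≡ L
    length-back = trans (cong (λ β → hittingTime h (tail₂ β) t₁) bit-back)
      (Least-unique (hittingTime-least h-inj (L , proj₁ hits)) hits)
      where
      hits : Least (λ k → fold (tail₂ b₀) h k ≡ t₁) L
      hits = subst (λ z → Least (λ k → fold z h k ≡ t₁) L) y≡tail₂ Back.hits

    x-back : tail₂ (fromQ-bit τ) ≡ y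
    x-back = trans (cong tail₂ bit-back) (sym y≡tail₂)

    succ-back : ∀ v → fromQ-succ τ v ≡ f v
    succ-back = Back.involutive x-back length-back (sym f-s₁)
      (trans (cong head₂ bit-back) (trans (sym f-e₂) (cong f (sym y≡tail₂))))

    bits-back : fromQ-bits τ (toQ-bits σ b₀ bs) ≡ b₀ ∷ bs
    bits-back = cong₂ _∷_ bit-back
      (toggle-involutive bs (λ j → sym (Back.onPath-does x-back length-back (s₃₊ j))))

    cover-back : tabulate (fromQ-succ τ) ≡ σ
    cover-back = trans (tabulate-cong succ-back) (tabulate∘lookup σ)

  module FromQ (τ : Vec (Fin n) n) (c : Vec Bool m)
               (cover : IsCycleCover (PatternGraph E (patQ s t c)) τ) where

    f : Fin n → Fin n
    f = lookup τ

    f-inj : Injective _≡_ _≡_ f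
    f-inj = cover-injective cover

    f-s₁ : f s₁ ≡ s₂
    f-s₁ = respects-head (cover-respects cover)

    f-t₁ : f t₁ ≡ t₂
    f-t₁ = respects-head (respects-tail (cover-respects cover))

    data Bit : Bool → Set where
      same-cycle   : Reach f s₁ t₁ → Bit false
      other-cycles : ¬ Reach f s₁ t₁ → Bit true

    bit : Bit (fromQ-bit τ)
    bit with reachBefore? n (lookup τ) s₁ t₁
    ... | yes (k , _ , eq) = same-cycle (k , eq)
    ... | no ¬s₁⇝t₁        = other-cycles (¬s₁⇝t₁ ∘ reach⇒reachBefore f-inj)

    reach-t₁ : ∀ {β} → Bit β → Reach f (tail₂ β) t₁
    reach-t₁ (same-cycle s₁⇝t₁) = subst (λ z → Reach f z t₁) f-s₁ (reach-succ s₁⇝t₁ (s≢t _ _))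
    reach-t₁ (other-cycles _)   = reach-sym f-inj (1 , f-t₁)

    module Oriented {β : Bool} (b : Bit β) where

      x : Fin n
      x = tail₂ β

      M : ℕ
      M = hittingTime f x t₁

      least : Least (λ k → fold x f k ≡ t₁) M
      least = hittingTime-least f-inj (reach-t₁ b)

      path : IsPath f x M
      path = least⇒isPath f-inj least

      y≡t₁ : fold x f M ≡ t₁
      y≡t₁ = proj₁ least

      s₁∉path : ¬ ReachBefore (suc M) f x s₁
      s₁∉path = off b
        where
        off : Bit β → ¬ ReachBefore (suc M) f x s₁
        off (same-cycle _) = predecessor-off-path path f-s₁ λ s₁≡y → s≢t _ _ (trans s₁≡y y≡t₁)
        off (other-cycles ¬s₁⇝t₁) (k , _ , eq) =
          ¬s₁⇝t₁ (reach-sym f-inj (reach-trans (1 , f-t₁) (k , eq)))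

      open Reversal path s₁∉path t₁ (head₂ β)

      t₂-boundary : ∀ {v} → v ≡ s₂ ⊎ v ≡ t₂ → Boundary v
      t₂-boundary (inj₁ v≡s₂) = inj₁ (trans v≡s₂ (sym f-s₁))
      t₂-boundary (inj₂ v≡t₂) = inj₂ (inj₂ (trans v≡t₂ (trans (sym f-t₁) (cong f (sym y≡t₁)))))

      g-injective : Injective _≡_ _≡_ g
      g-injective = reversal-injective f-inj (proj₂ t₁∉e₂) (proj₁ t₁∉e₂) (tail₂≢head₂ β ∘ sym)
        (inj₂ (inj₁ (sym y≡t₁))) (t₂-boundary (head₂-end β)) (t₂-boundary (tail₂-end β))
        where
        t₁∉e₂ : t₁ ≢ tail₂ β × t₁ ≢ head₂ β
        t₁∉e₂ = avoids-e₂ (t≢s _ _) (t-distinct λ ()) β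

      g-follows : ∀ j → Follows g (orient (lookup (toggle c (onPath-bits f x M)) j) (s₃₊ j) (t₃₊ j))
      g-follows j = subst (λ β → Follows g (orient β (s₃₊ j) (t₃₊ j))) (sym (lookup∘tabulate _ j))
        (reversal-follows f-inj (s-distinct λ ()) (t≢s _ _)
          (proj₁ (avoids-e₂ (s-distinct λ ()) (s≢t _ _) β)) (≢y (s≢t _ _)) (≢y (t-distinct λ ()))
          (lookup c j) (patQ-follows c (cover-respects cover) j))
        where
        ≢y : ∀ {v} → v ≢ t₁ → v ≢ y
        ≢y v≢t₁ v≡y = v≢t₁ (trans v≡y y≡t₁)

      isCover : IsCycleCover (PatternGraph E (patP s t (β ∷ toggle c (onPath-bits f x M)))) (tabulate g)
      isCover = tabulate-isCycleCover g-injective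
        (reversal-arcs E E-sym (E-st zero) (E-e₂ β) (cover-arcs cover))
        (patP-respects {g} (β ∷ toggle c (onPath-bits f x M)) reversal-a follows)
        where
        follows : ∀ j
          → Follows g (orient (lookup (β ∷ toggle c (onPath-bits f x M)) j) (s (suc j)) (t (suc j)))
        follows zero    = reversal-x
        follows (suc j) = g-follows j

      σ′ : Vec (Fin n) n
      σ′ = tabulate g

      h : Fin n → Fin n
      h = lookup σ′

      h-inj : Injective _≡_ _≡_ h
      h-inj = cover-injective isCover

      module Back = Reversed path s₁∉path (lookup∘tabulate g)

      hits : Least (λ k → fold t₁ h k ≡ x) M
      hits = subst (λ z → Least (λ k → fold z h k ≡ x) M) y≡t₁ Back.hits

      sameCycle : SameCycle σ′ s₁ s₂
      sameCycle = reach⇒sameCycle (reach-s₂ β s₁⇝x (trans (lookup∘tabulate g x) reversal-x))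
        where
        s₁⇝x : Reach h s₁ x
        s₁⇝x = reach-trans (1 , trans (lookup∘tabulate g s₁) reversal-a) (M , proj₁ hits)

      length-back : toQ-length σ′ β ≡ M
      length-back = Least-unique (hittingTime-least h-inj (M , proj₁ hits)) hits

      succ-back : ∀ v → toQ-succ σ′ β v ≡ f v
      succ-back = Back.involutive (sym y≡t₁) length-back (sym f-s₁)
        (trans (sym f-t₁) (cong f (sym y≡t₁)))

      bits-back : toQ-bits σ′ β (toggle c (onPath-bits f x M)) ≡ c
      bits-back = toggle-involutive c (λ j → sym (Back.onPath-does (sym y≡t₁) length-back (s₃₊ j)))

      cover-back : tabulate (toQ-succ σ′ β) ≡ τ
      cover-back = trans (tabulate-cong succ-back) (tabulate∘lookup τ)

    open Oriented bit public

  toQ : CP E s t → CQ E s t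
  toQ (b₀ ∷ bs , (σ , [ cover ]) , [ same ]) =
    toQ-bits σ b₀ bs , (tabulate (toQ-succ σ b₀) , [ ToQ.isCover σ b₀ bs cover (sameCycle⇒reach same) ])

  fromQ : CQ E s t → CP E s t
  fromQ (c , (τ , [ cover ])) =
    fromQ-bits τ c , (tabulate (fromQ-succ τ) , [ FromQ.isCover τ c cover ]) , [ FromQ.sameCycle τ c cover ]

  CP-≡ : ∀ {b b′ σ σ′} {cover cover′ same same′} → b ≡ b′ → σ ≡ σ′
    → _≡_ {A = CP E s t} (b , (σ , cover) , same) (b′ , (σ′ , cover′) , same′)
  CP-≡ refl refl = refl

  CQ-≡ : ∀ {c c′ τ τ′} {cover cover′} → c ≡ c′ → τ ≡ τ′
    → _≡_ {A = CQ E s t} (c , (τ , cover)) (c′ , (τ′ , cover′))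
  CQ-≡ refl refl = refl

  -- The cover proofs are irrelevant, so equations depending on them are
  -- recomputed from the decidability of equality of vectors.
  fromQ∘toQ : ∀ p → fromQ (toQ p) ≡ p
  fromQ∘toQ (b₀ ∷ bs , (σ , [ cover ]) , [ same ]) =
    CP-≡ (recompute (≡-dec Bool._≟_ _ _) (ToQ.bits-back σ b₀ bs cover (sameCycle⇒reach same)))
         (recompute (≡-dec _≟ᶠ_ _ _) (ToQ.cover-back σ b₀ bs cover (sameCycle⇒reach same)))

  toQ∘fromQ : ∀ q → toQ (fromQ q) ≡ q
  toQ∘fromQ (c , (τ , [ cover ])) =
    CQ-≡ (recompute (≡-dec Bool._≟_ _ _) (FromQ.bits-back τ c cover))
         (recompute (≡-dec _≟ᶠ_ _ _) (FromQ.cover-back τ c cover))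

claim2 : {n m : ℕ} (E : Fin n → Fin n → Set) (s t : Fin (suc (suc m)) → Fin n)
    → (∀ u v → E u v → E v u)
    → (∀ i → E (s i) (t i))
    → (∀ i j → s i ≡ s j → i ≡ j)
    → (∀ i j → t i ≡ t j → i ≡ j)
    → (∀ i j → s i ≢ t j)
    → (∀ v → (∀ i → v ≢ s i × v ≢ t i) → E v v)
    → E (s zero) (s (suc zero))
    → E (t zero) (t (suc zero))
    → CP E s t ⤖ CQ E s t
claim2 E s t E-sym E-st s-inj t-inj s≢t _ E-s₁s₂ E-t₁t₂ = ↔⇒⤖ (mk↔ₛ′ toQ fromQ toQ∘fromQ fromQ∘toQ)
  where open MarkedEdges E s t E-sym E-st s-inj t-inj s≢t E-s₁s₂ E-t₁t₂
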